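{- Assume $B$ is countable (finite or countably infinite), and let $C$ be a pmf clone. (1) If for every finite $f\colon B^n\rightrightarrows B^m$ in $C$ and every $a\in B^n$ there exists $b\in B^m$ with $f\cup\{(a,b)\}\in C$, then for every finite $f\colon B^n\rightrightarrows B^m$ in $C$ there exists a total multifunction $\bar f\colon B^n\rightrightarrows B^m$ in $C$ with $f\subseteq\bar f$. (2) If moreover also for every finite $f\colon B^n\rightrightarrows B^m$ in $C$ and every $b\in B^m$ there exists $a\in B^n$ with $f\cup\{(a,b)\}\in C$, then for every finite $f\colon B^n\rightrightarrows B^m$ in $C$ there exists a total surjective multifunction $\bar f\colon B^n\rightrightarrows B^m$ in $C$ with $f\subseteq\bar f$.
   Context: For $n,m\in\mathbb N$, a partial multi-valued function (pmf) $f\colon B^n\rightrightarrows B^m$ is a relation $f\subseteq B^n\times B^m$; write $f(x)\approx y$ for $(x,y)\in f$. It is a total multifunction if every $x\in B^n$ has some $y$ with $f(x)\approx y$, and surjective if every $y\in B^m$ has some $x$ with $f(x)\approx y$. A pmf clone is a set $C$ of pmf (of all $n,m$) such that: (I) for each $n,m$, a pmf $f\colon B^n\rightrightarrows B^m$ lies in $C$ iff every finite subset of $f$ lies in $C$ (equivalently, $C\cap\mathrm{Pmf}_{n,m}$ is closed in $\mathbf 2_S^{B^n\times B^m}$ with $\mathbf 2_S$ the Sierpiński space); (II) $\mathrm{id}_n\in C$ for all $n$; (III) $C$ is closed under composition, $(g\circ f)(x)\approx z$ iff $f(x)\approx y$ and $g(y)\approx z$ for some $y$; (IV) $C$ is closed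 under $f\times g$, where $(f\times g)(x,x')\approx(y,y')$ iff $f(x)\approx y$ and $g(x')\approx y'$. -}

module Defs where

open import Level using (Level; _⊔_) renaming (suc to lsuc; zero to 0ℓ)
open import Data.Nat using (ℕ; _+_)
open import Data.Maybe using (Maybe; just)
open import Data.Vec using (Vec; take; drop)
open import Data.List using (List)
open import Data.List.Membership.Propositional using (_∈_)
open import Data.Product using (Σ; ∃; _×_; _,_)
open import Data.Sum using (_⊎_)
open import Relation.Binary.PropositionalEquality using (_≡_)

-- B is countable (finite or countably infinite, possibly empty):
-- there is a surjection ℕ → Maybe B onto the `just` values.
Countable : Set → Set
Countable B = Σ (ℕ → Maybe B) λ e → ∀ b → ∃ λ k → e k ≡ just b

-- A partial multi-valued function f : Bⁿ ⇉ Bᵐ is a relation f ⊆ Bⁿ × Bᵐ;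
-- f x y means f(x) ≈ y.
Pmf : Set → ℕ → ℕ → Set₁
Pmf B n m = Vec B n → Vec B m → Set

module _ {B : Set} where

  _⊆_ : ∀ {n m} → Pmf B n m → Pmf B n m → Set
  f ⊆ g = ∀ x y → f x y → g x y

  Finite : ∀ {n m} → Pmf B n m → Set
  Finite {n} {m} f = Σ (List (Vec B n × Vec B m)) λ L →
    ∀ x y → (f x y → (x , y) ∈ L) × ((x , y) ∈ L → f x y)

  insert : ∀ {n m} → Pmf B n m → Vec B n → Vec B m → Pmf B n m
  insert f a b x y = f x y ⊎ (x ≡ a × y ≡ b)

  Total : ∀ {n m} → Pmf B n m → Set
  Total f = ∀ x → ∃ λ y → f x y

  Surjective : ∀ {n m} → Pmf B n m → Set
  Surjective f = ∀ y → ∃ λ x → f x y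

  idₚ : ∀ n → Pmf B n n
  idₚ n x y = x ≡ y

  _∘ₚ_ : ∀ {n m k} → Pmf B m k → Pmf B n m → Pmf B n k
  _∘ₚ_ {m = m} g f x z = ∃ λ (y : Vec B m) → f x y × g y z

  _×ₚ_ : ∀ {n m n' m'} → Pmf B n m → Pmf B n' m' → Pmf B (n + n') (m + m')
  _×ₚ_ {n} {m} f g xx yy = f (take n xx) (take m yy) × g (drop n xx) (drop m yy)

PmfSet : Set → Set₁
PmfSet B = ∀ {n m} → Pmf B n m → Set

record IsPmfClone {B : Set} (C : PmfSet B) : Set₁ where
  field
    finitary : ∀ {n m} (f : Pmf B n m) →
      (C f → ∀ (g : Pmf B n m) → Finite g → g ⊆ f → C g) ×
      ((∀ (g : Pmf B n m) → Finite g → g ⊆ f → C g) → C f)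
    id-closed : ∀ n → C (idₚ n)
    ∘-closed : ∀ {n m k} (g : Pmf B m k) (f : Pmf B n m) → C g → C f → C (g ∘ₚ f)
    ×-closed : ∀ {n m n' m'} (f : Pmf B n m) (g : Pmf B n' m') → C f → C g → C (f ×ₚ g)

ExtendableDom : {B : Set} → PmfSet B → Set₁
ExtendableDom {B} C = ∀ {n m} (f : Pmf B n m) → Finite f → C f →
  ∀ (a : Vec B n) → ∃ λ (b : Vec B m) → C (insert f a b)

ExtendableCod : {B : Set} → PmfSet B → Set₁
ExtendableCod {B} C = ∀ {n m} (f : Pmf B n m) → Finite f → C f →
  ∀ (b : Vec B m) → ∃ λ (a : Vec B n) → C (insert f a b)

-- A total (and surjective) extension of a finite f ∈ C is built as the union of an
-- increasing chain f = f₀ ⊆ f₁ ⊆ ⋯ of finite members of C: since Bⁿ (and Bᵐ) is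
-- countable, the hypotheses let stage k+1 add an output at the k-th input (and an
-- input at the k-th output). Every finite subset of the union lies in some stage,
-- so the union is in C by the finitary closure condition (I).
module Submission where

open import Defs
open import Function using (_∘_)
open import Data.Nat using (ℕ; zero; suc; _+_; _⊔_; _≤′_; ≤′-refl; ≤′-step)
open import Data.Nat.Properties using (+-identityʳ; +-suc; ≤⇒≤′; m≤m⊔n; m≤n⊔m)
open import Data.Maybe as Maybe using (Maybe; just; nothing)
open import Data.Vec using (Vec; []; _∷_)
open import Data.List using (List; []; _∷_)
open import Data.List.Relation.Unary.Any using (here; there)
open import Data.List.Membership.Propositional using (_∈_)
open import Data.Product using (Σ; ∃; _×_; _,_; proj₁; proj₂; uncurry)
open import Data.Sum using (_⊎_; inj₁; inj₂; [_,_]; [_,_]′)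
open import Relation.Binary.PropositionalEquality
  using (_≡_; refl; sym; trans; cong; cong₂; subst; module ≡-Reasoning)

next : ℕ × ℕ → ℕ × ℕ
next (zero  , j) = suc j , zero
next (suc i , j) = i , suc j

-- Cantor's zig-zag enumeration of ℕ × ℕ along the antidiagonals i + j = const.
unpair : ℕ → ℕ × ℕ
unpair zero    = zero , zero
unpair (suc k) = next (unpair k)

Reachable : ℕ × ℕ → Set
Reachable p = ∃ λ k → unpair k ≡ p

reachable-next : ∀ {p} → Reachable p → Reachable (next p)
reachable-next (k , eq) = suc k , cong next eq

reachable-antidiagonal : ∀ i j → Reachable (i + j , zero) → Reachable (i , j)
reachable-antidiagonal i zero r = subst (λ t → Reachable (t , zero)) (+-identityʳ i) r
reachable-antidiagonal i (suc j) r =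
  reachable-next (reachable-antidiagonal (suc i) j (subst (λ t → Reachable (t , zero)) (+-suc i j) r))

reachable-axis : ∀ s → Reachable (s , zero)
reachable-axis zero    = zero , refl
reachable-axis (suc s) = reachable-next (reachable-antidiagonal zero s (reachable-axis s))

unpair-surjective : ∀ i j → Reachable (i , j)
unpair-surjective i j = reachable-antidiagonal i j (reachable-axis (i + j))

module _ {A B : Set} where
  open ≡-Reasoning

  countable-map : (f : A → B) → (∀ b → ∃ λ a → f a ≡ b) → Countable A → Countable B
  countable-map f f-surjective (e , e-surjective) = Maybe.map f ∘ e , λ b →
    let (a , fa≡b) = f-surjective b ; (k , ek≡a) = e-surjective a
    in k , trans (cong (Maybe.map f) ek≡a) (cong just fa≡b)

  countable-× : Countable A → Countable B → Countable (A × B)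
  countable-× (eA , eA-surjective) (eB , eB-surjective) = zipEnum ∘ unpair , λ (a , b) →
    let (i , eAi≡a) = eA-surjective a ; (j , eBj≡b) = eB-surjective b
        (k , unpairk≡ij) = unpair-surjective i j
    in k , (begin
      zipEnum (unpair k)        ≡⟨ cong zipEnum unpairk≡ij ⟩
      Maybe.zip (eA i) (eB j)   ≡⟨ cong₂ Maybe.zip eAi≡a eBj≡b ⟩
      just (a , b)              ∎)
    where
    zipEnum : ℕ × ℕ → Maybe (A × B)
    zipEnum (i , j) = Maybe.zip (eA i) (eB j)

  countable-⊎ : Countable A → Countable B → Countable (A ⊎ B)
  countable-⊎ (eA , eA-surjective) (eB , eB-surjective) = selectEnum ∘ unpair , λ where
      (inj₁ a) → let (j , eAj≡a) = eA-surjective a ; (k , unpairk≡0j) = unpair-surjective 0 j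
                 in k , trans (cong selectEnum unpairk≡0j) (cong (Maybe.map inj₁) eAj≡a)
      (inj₂ b) → let (j , eBj≡b) = eB-surjective b ; (k , unpairk≡1j) = unpair-surjective 1 j
                 in k , trans (cong selectEnum unpairk≡1j) (cong (Maybe.map inj₂) eBj≡b)
    where
    selectEnum : ℕ × ℕ → Maybe (A ⊎ B)
    selectEnum (zero  , j) = Maybe.map inj₁ (eA j)
    selectEnum (suc _ , j) = Maybe.map inj₂ (eB j)

countable-Vec : ∀ {B} → Countable B → ∀ n → Countable (Vec B n)
countable-Vec B-countable zero    = (λ _ → just []) , λ { [] → zero , refl }
countable-Vec B-countable (suc n) =
  countable-map (uncurry _∷_) (λ { (x ∷ xs) → (x , xs) , refl })
    (countable-× B-countable (countable-Vec B-countable n))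

module _ {B : Set} {n m : ℕ} where

  ⋃ : (ℕ → Pmf B n m) → Pmf B n m
  ⋃ S x y = ∃ λ k → S k x y

  Upward : (Pmf B n m → Set) → Set₁
  Upward R = ∀ {g h} → g ⊆ h → R g → R h

  Ascending : (ℕ → Pmf B n m) → Set
  Ascending S = ∀ k → S k ⊆ S (suc k)

  module _ {S : ℕ → Pmf B n m} (S-ascending : Ascending S) where

    ascending-mono : ∀ {k l} → k ≤′ l → S k ⊆ S l
    ascending-mono ≤′-refl        x y Skxy = Skxy
    ascending-mono (≤′-step k≤′l) x y Skxy = S-ascending _ x y (ascending-mono k≤′l x y Skxy)

    list-⊆-stage : (L : List (Vec B n × Vec B m)) → (∀ {x y} → (x , y) ∈ L → ⋃ S x y) →
                   ∃ λ K → ∀ {x y} → (x , y) ∈ L → S K x y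
    list-⊆-stage []            L⊆⋃ = zero , λ ()
    list-⊆-stage ((x , y) ∷ L) L⊆⋃ =
      let (k , Skxy) = L⊆⋃ (here refl) ; (K , L⊆SK) = list-⊆-stage L (L⊆⋃ ∘ there)
      in k ⊔ K , λ where
           (here refl) → ascending-mono (≤⇒≤′ (m≤m⊔n k K)) x y Skxy
           (there p)   → ascending-mono (≤⇒≤′ (m≤n⊔m k K)) _ _ (L⊆SK p)

    finite-⊆-⋃⇒⊆-stage : ∀ g → Finite g → g ⊆ ⋃ S → ∃ λ K → g ⊆ S K
    finite-⊆-⋃⇒⊆-stage g (L , g≗L) g⊆⋃ =
      let (K , L⊆SK) = list-⊆-stage L (λ {x} {y} xy∈L → g⊆⋃ x y (proj₂ (g≗L x y) xy∈L))
      in K , λ x y gxy → L⊆SK (proj₁ (g≗L x y) gxy)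

module _ {B : Set} {C : PmfSet B} (C-clone : IsPmfClone C) {n m : ℕ} where
  open IsPmfClone C-clone using (finitary)

  ⋃-closed : ∀ {S : ℕ → Pmf B n m} → Ascending S → (∀ k → C (S k)) → C (⋃ S)
  ⋃-closed {S} S-ascending S∈C = proj₂ (finitary (⋃ S)) λ g g-finite g⊆⋃ →
    let (K , g⊆SK) = finite-⊆-⋃⇒⊆-stage S-ascending g g-finite g⊆⋃
    in proj₁ (finitary (S K)) (S∈C K) g g-finite g⊆SK

  record FiniteMember : Set₁ where
    constructor finiteMember
    field
      pmf    : Pmf B n m
      finite : Finite pmf
      member : C pmf

  open FiniteMember

  Dense : (Pmf B n m → Set) → Set₁
  Dense R = (s : FiniteMember) → Σ FiniteMember λ t → pmf s ⊆ pmf t × R (pmf t)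

  meet-countably-many : ∀ {I : Set} → Countable I → (R : I → Pmf B n m → Set) →
    (∀ i → Upward (R i)) → (∀ i → Dense (R i)) →
    (f : FiniteMember) → Σ (Pmf B n m) λ f̄ → C f̄ × pmf f ⊆ f̄ × ∀ i → R i f̄
  meet-countably-many {I} (e , e-surjective) R R-upward R-dense f =
    ⋃ S , ⋃-closed S-ascending (member ∘ chain) , (λ x y fxy → zero , fxy) , meets
    where
    advance : Maybe I → FiniteMember → FiniteMember
    advance nothing  s = s
    advance (just i) s = proj₁ (R-dense i s)

    advance-⊆ : ∀ o s → pmf s ⊆ pmf (advance o s)
    advance-⊆ nothing  s x y sxy = sxy
    advance-⊆ (just i) s         = proj₁ (proj₂ (R-dense i s))

    chain : ℕ → FiniteMember
    chain zero    = f
    chain (suc k) = advance (e k) (chain k)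

    S : ℕ → Pmf B n m
    S = pmf ∘ chain

    S-ascending : Ascending S
    S-ascending k = advance-⊆ (e k) (chain k)

    meets : ∀ i → R i (⋃ S)
    meets i =
      let (k , ek≡i) = e-surjective i
          R-at-suc-k = subst (λ o → R i (pmf (advance o (chain k)))) (sym ek≡i)
                             (proj₂ (proj₂ (R-dense i (chain k))))
      in R-upward i (λ x y Sxy → suc k , Sxy) R-at-suc-k

module _ {B : Set} {n m : ℕ} where

  insert-finite : ∀ {g : Pmf B n m} → Finite g → ∀ a b → Finite (insert g a b)
  insert-finite {g} (L , g≗L) a b = (a , b) ∷ L , λ x y → to x y , from x y
    where
    to : ∀ x y → insert g a b x y → (x , y) ∈ (a , b) ∷ L
    to x y (inj₁ gxy)          = there (proj₁ (g≗L x y) gxy)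
    to x y (inj₂ (refl , refl)) = here refl
    from : ∀ x y → (x , y) ∈ (a , b) ∷ L → insert g a b x y
    from x y (here refl)  = inj₂ (refl , refl)
    from x y (there xy∈L) = inj₁ (proj₂ (g≗L x y) xy∈L)

  DefinedAt : Vec B n → Pmf B n m → Set
  DefinedAt a g = ∃ λ y → g a y

  Attains : Vec B m → Pmf B n m → Set
  Attains b g = ∃ λ x → g x b

  definedAt-upward : ∀ a → Upward (DefinedAt a)
  definedAt-upward a g⊆h (y , gay) = y , g⊆h a y gay

  attains-upward : ∀ b → Upward (Attains b)
  attains-upward b g⊆h (x , gxb) = x , g⊆h x b gxb

module _ {B : Set} {C : PmfSet B} (C-clone : IsPmfClone C) {n m : ℕ} where

  definedAt-dense : ExtendableDom C → ∀ a → Dense C-clone (DefinedAt {n = n} {m} a)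
  definedAt-dense extendable a (finiteMember g g-finite g∈C) =
    let (b , g+ab∈C) = extendable g g-finite g∈C a
    in finiteMember (insert g a b) (insert-finite g-finite a b) g+ab∈C ,
       (λ x y → inj₁) , b , inj₂ (refl , refl)

  attains-dense : ExtendableCod C → ∀ b → Dense C-clone (Attains {n = n} {m} b)
  attains-dense extendable b (finiteMember g g-finite g∈C) =
    let (a , g+ab∈C) = extendable g g-finite g∈C b
    in finiteMember (insert g a b) (insert-finite g-finite a b) g+ab∈C ,
       (λ x y → inj₁) , a , inj₂ (refl , refl)

lemma5p12 : {B : Set} → Countable B → (C : PmfSet B) → IsPmfClone C →
    (ExtendableDom C →
      ∀ {n m} (f : Pmf B n m) → Finite f → C f →
        Σ (Pmf B n m) λ f̄ → C f̄ × Total f̄ × f ⊆ f̄)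
  × (ExtendableDom C → ExtendableCod C →
      ∀ {n m} (f : Pmf B n m) → Finite f → C f →
        Σ (Pmf B n m) λ f̄ → C f̄ × Total f̄ × Surjective f̄ × f ⊆ f̄)
lemma5p12 {B} B-countable C C-clone = total-extension , total-surjective-extension
  where
  total-extension : ExtendableDom C → ∀ {n m} (f : Pmf B n m) → Finite f → C f →
    Σ (Pmf B n m) λ f̄ → C f̄ × Total f̄ × f ⊆ f̄
  total-extension extendableDom {n} {m} f f-finite f∈C =
    let (f̄ , f̄∈C , f⊆f̄ , definedEverywhere) =
          meet-countably-many C-clone (countable-Vec B-countable n) DefinedAt
            definedAt-upward (definedAt-dense C-clone extendableDom)
            (finiteMember f f-finite f∈C)
    in f̄ , f̄∈C , definedEverywhere , f⊆f̄

  total-surjective-extension : ExtendableDom C → ExtendableCod C →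
    ∀ {n m} (f : Pmf B n m) → Finite f → C f →
    Σ (Pmf B n m) λ f̄ → C f̄ × Total f̄ × Surjective f̄ × f ⊆ f̄
  total-surjective-extension extendableDom extendableCod {n} {m} f f-finite f∈C =
    let (f̄ , f̄∈C , f⊆f̄ , meetsAll) =
          meet-countably-many C-clone
            (countable-⊎ (countable-Vec B-countable n) (countable-Vec B-countable m))
            [ DefinedAt , Attains ]′
            [ definedAt-upward , attains-upward ]
            [ definedAt-dense C-clone extendableDom , attains-dense C-clone extendableCod ]
            (finiteMember f f-finite f∈C)
    in f̄ , f̄∈C , meetsAll ∘ inj₁ , meetsAll ∘ inj₂ , f⊆f̄
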